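{- Let $n\ge2$, let $k_n=\lceil\log_2 n\rceil$ (so $n\in(2^{k_n-1},2^{k_n}]$), and let $T^{gfb}_n=(T_a,T_b)$ be the GFB tree with $n$ leaves, where $T_a,T_b$ have $n_a\ge n_b$ leaves. Then: (1) if $n\in(2^{k_n-1},3\cdot2^{k_n-2})$, then $n_a=n-2^{k_n-2}$ and $n_b=2^{k_n-2}$; in particular $T_b$ is the fully balanced tree of height $k_n-2$ and $\lceil\log_2 n_a\rceil=k_n-1$; (2) if $n=3\cdot2^{k_n-2}$, then $n_a=2^{k_n-1}$ and $n_b=2^{k_n-2}$; in particular $T_a$ is the fully balanced tree of height $k_n-1$ and $T_b$ is the fully balanced tree of height $k_n-2$; (3) if $n\in(3\cdot2^{k_n-2},2^{k_n}]$, then $n_a=2^{k_n-1}$ and $n_b=n-2^{k_n-1}$; in particular $T_a$ is the fully balanced tree of height $k_n-1$ and $\lceil\log_2 n_b\rceil=k_n-1$.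
   Context: A rooted binary tree with $n\ge2$ leaves is a rooted tree in which the root has degree 2 and every other internal vertex has degree 3 (each internal vertex has exactly two children); the single vertex is the rooted binary tree with one leaf. $T=(T_a,T_b)$ denotes the decomposition into the subtrees rooted at the two children of the root. The fully balanced tree of height $k$ is the rooted binary tree with $2^k$ leaves all at depth $k$. The GFB tree $T^{gfb}_n$ is the output (up to isomorphism) of the algorithm: start with $n$ single-vertex trees; while more than one tree remains, remove a tree $u$ with minimum number of leaves, then a tree $v$ with minimum number of leaves among the remaining, and add the tree with a new root whose children are the roots of $u$ and $v$. -}

module Defs where

open import Data.Nat using (ℕ; zero; suc; _+_; _≤_)
open import Data.List using (List; []; _∷_; replicate)
open import Data.List.Relation.Unary.All using (All)
open import Relation.Binary.Construct.Closure.ReflexiveTransitive using (Star)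

-- Rooted binary trees (children unordered up to isomorphism, see _≅_).
data Tree : Set where
  leaf : Tree
  node : Tree → Tree → Tree

leaves : Tree → ℕ
leaves leaf       = 1
leaves (node a b) = leaves a + leaves b

data _≅_ : Tree → Tree → Set where
  leaf≅ : leaf ≅ leaf
  node≅ : ∀ {a b c d} → a ≅ c → b ≅ d → node a b ≅ node c d
  swap≅ : ∀ {a b c d} → a ≅ d → b ≅ c → node a b ≅ node c d

fb : ℕ → Tree
fb zero    = leaf
fb (suc k) = node (fb k) (fb k)

data Pick : Tree → List Tree → List Tree → Set where
  here  : ∀ {x xs} → Pick x (x ∷ xs) xs
  there : ∀ {x y xs ys} → Pick x xs ys → Pick x (y ∷ xs) (y ∷ ys)

-- One step of the GFB algorithm on the current collection (multiset) of trees: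
-- remove a tree u with minimum number of leaves, then a tree v with minimum
-- number of leaves among the remaining ones, add the tree with root children u, v.
data GFBStep : List Tree → List Tree → Set where
  step : ∀ {xs ys zs u v} →
         Pick u xs ys → All (λ t → leaves u ≤ leaves t) ys →
         Pick v ys zs → All (λ t → leaves v ≤ leaves t) zs →
         GFBStep xs (node u v ∷ zs)

-- t is a possible output of the GFB algorithm started from n single-vertex trees
-- (any tie-breaking).
IsGFB : ℕ → Tree → Set
IsGFB n t = Star GFBStep (replicate n leaf) (t ∷ [])

-- Throughout the algorithm the collection sits at some level j: every tree is
-- fb j or fb (j + 1), except for at most one "intermediate" tree whose number of
-- leaves lies strictly between 2 ^ j and 2 ^ (j + 1). Merging the two smallest
-- trees preserves this (possibly moving to level j + 1), and it also shows that
-- every tree built along the way has one of only four possible root splits.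
-- The final tree therefore has one of these four splits, and each of them
-- falls into exactly one of the three ranges of the statement.
module Submission where

open import Defs
open import Data.Bool using (Bool; true; false)
open import Data.Empty using (⊥-elim)
open import Data.List using (List; []; _∷_; replicate; map)
open import Data.Nat.ListAction using (sum)
open import Data.List.Relation.Unary.All as All using (All; []; _∷_)
open import Data.List.Relation.Unary.All.Properties using (replicate⁺)
open import Data.Nat using (ℕ; zero; suc; _+_; _*_; _∸_; _^_; _≤_; _<_; z≤n; s≤s; ⌊_/2⌋; ⌈_/2⌉)
open import Data.Nat.Logarithm using (⌈log₂_⌉; ⌈log₂⌉-mono-≤; ⌈log₂⌈n/2⌉⌉≡⌈log₂n⌉∸1; ⌈log₂2^n⌉≡n)
open import Data.Nat.Properties
open import Data.Nat.Tactic.RingSolver using (solve-∀)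
open import Data.Product using (_×_; _,_; ∃; proj₁; proj₂)
open import Data.Sum using (_⊎_; inj₁; inj₂)
open import Function using (id; _∘_; _$_)
open import Relation.Binary.Core using (Rel)
open import Relation.Binary.Definitions using (_Respects_)
open import Relation.Binary.Construct.Closure.ReflexiveTransitive using (Star; fold)
open import Relation.Binary.PropositionalEquality
  using (_≡_; refl; sym; trans; cong; cong₂; subst; subst₂; module ≡-Reasoning)

open import Algebra.Properties.CommutativeSemigroup +-commutativeSemigroup using (x∙yz≈y∙xz)

n+n≡2*n : ∀ n → n + n ≡ 2 * n
n+n≡2*n n = cong (n +_) (sym (+-identityʳ n))

2^n<2^[1+n] : ∀ n → 2 ^ n < 2 ^ suc n
2^n<2^[1+n] n = ^-monoʳ-< 2 (s≤s (s≤s z≤n)) (n<1+n n)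

2*m<n⇒m<⌈n/2⌉ : ∀ {m n} → 2 * m < n → m < ⌈ n /2⌉
2*m<n⇒m<⌈n/2⌉ {m} 2m<n = subst (_< ⌈ _ /2⌉) ⌊2m/2⌋≡m (⌈n/2⌉-mono 2m<n)
  where
  ⌊2m/2⌋≡m : ⌊ 2 * m /2⌋ ≡ m
  ⌊2m/2⌋≡m = sym (trans (n≡⌊n+n/2⌋ m) (cong ⌊_/2⌋ (n+n≡2*n m)))

m<n∸1⇒1+m<n : ∀ {m n} → m < n ∸ 1 → suc m < n
m<n∸1⇒1+m<n {n = suc n} m<n = s≤s m<n

m≤2^j⇒⌈log₂m⌉≤j : ∀ j {m} → m ≤ 2 ^ j → ⌈log₂ m ⌉ ≤ j
m≤2^j⇒⌈log₂m⌉≤j j {m} m≤2^j = subst (⌈log₂ m ⌉ ≤_) (⌈log₂2^n⌉≡n j) (⌈log₂⌉-mono-≤ m≤2^j)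

2^j<m⇒j<⌈log₂m⌉ : ∀ j {m} → 2 ^ j < m → j < ⌈log₂ m ⌉
2^j<m⇒j<⌈log₂m⌉ zero    1<m = ⌈log₂⌉-mono-≤ 1<m
2^j<m⇒j<⌈log₂m⌉ (suc j) {m} 2^[1+j]<m = m<n∸1⇒1+m<n (subst (j <_) (⌈log₂⌈n/2⌉⌉≡⌈log₂n⌉∸1 m) j<⌈log₂⌈m/2⌉⌉)
  where
  j<⌈log₂⌈m/2⌉⌉ : j < ⌈log₂ ⌈ m /2⌉ ⌉
  j<⌈log₂⌈m/2⌉⌉ = 2^j<m⇒j<⌈log₂m⌉ j (2*m<n⇒m<⌈n/2⌉ 2^[1+j]<m)

⌈log₂m⌉≡1+j : ∀ j {m} → 2 ^ j < m → m ≤ 2 ^ suc j → ⌈log₂ m ⌉ ≡ suc j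
⌈log₂m⌉≡1+j j lo hi = ≤-antisym (m≤2^j⇒⌈log₂m⌉≤j (suc j) hi) (2^j<m⇒j<⌈log₂m⌉ j lo)

FullyBalanced : ℕ → Tree → Set
FullyBalanced j t = leaves t ≡ 2 ^ j × t ≅ fb j

record Intermediate (j : ℕ) (t : Tree) : Set where
  constructor between
  field
    lower : 2 ^ j < leaves t
    upper : leaves t < 2 ^ suc j

node-fullyBalanced : ∀ {j u v} → FullyBalanced j u → FullyBalanced j v →
                     FullyBalanced (suc j) (node u v)
node-fullyBalanced {j} (#u , u≅) (#v , v≅) = trans (cong₂ _+_ #u #v) (n+n≡2*n (2 ^ j)) , node≅ u≅ v≅

node-intermediate : ∀ {j u v a b} → let P = 2 ^ j in leaves u ≡ a → leaves v ≡ b →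
  P + P < a + b → a + b < 2 * P + 2 * P → Intermediate (suc j) (node u v)
node-intermediate {j} {u} {v} refl refl lo hi =
  between (subst (_< leaves u + leaves v) (n+n≡2*n (2 ^ j)) lo)
          (subst (leaves u + leaves v <_) (n+n≡2*n (2 ^ suc j)) hi)

-- In node u v, u is the subtree picked first, so leaves u ≤ leaves v.
data RootSplit : Tree → Set where
  leaf                  : RootSplit leaf
  balanced              : ∀ {j u v} → FullyBalanced j u → FullyBalanced j v → RootSplit (node u v)
  balanced-intermediate : ∀ {j u v} → FullyBalanced j u → Intermediate j v → RootSplit (node u v)
  balanced-taller       : ∀ {j u v} → FullyBalanced j u → FullyBalanced (suc j) v → RootSplit (node u v)
  intermediate-taller   : ∀ {j u v} → Intermediate j u → FullyBalanced (suc j) v → RootSplit (node u v)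

data Layered (j : ℕ) : Bool → List Tree → Set where
  []           : ∀ {g} → Layered j g []
  balanced     : ∀ {g t ts} → FullyBalanced j t ⊎ FullyBalanced (suc j) t →
                 Layered j g ts → Layered j g (t ∷ ts)
  intermediate : ∀ {t ts} → Intermediate j t → Layered j false ts → Layered j true (t ∷ ts)

data Picked (j : ℕ) (x : Tree) (ys : List Tree) : Bool → Set where
  balanced     : ∀ {g} → FullyBalanced j x ⊎ FullyBalanced (suc j) x →
                 Layered j g ys → Picked j x ys g
  intermediate : Intermediate j x → Layered j false ys → Picked j x ys true

pick-layered : ∀ {j g x xs ys} → Pick x xs ys → Layered j g xs → Picked j x ys g
pick-layered here (balanced b s)     = balanced b s
pick-layered here (intermediate i s) = intermediate i s
pick-layered (there p) (balanced b s) with pick-layered p s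
... | balanced b′ s′     = balanced b′ (balanced b s′)
... | intermediate i′ s′ = intermediate i′ (balanced b s′)
pick-layered (there p) (intermediate i s) with pick-layered p s
... | balanced b′ s′ = balanced b′ (intermediate i s′)

raise : ∀ {j g g′ ts} → Layered j g ts → All (λ t → 2 ^ suc j ≤ leaves t) ts →
        Layered (suc j) g′ ts
raise [] [] = []
raise {j} (balanced (inj₁ (#t , _)) _) (big ∷ _) =
  ⊥-elim (<⇒≱ (2^n<2^[1+n] j) (subst (2 ^ suc j ≤_) #t big))
raise (balanced (inj₂ b) s) (_ ∷ bigs) = balanced (inj₁ b) (raise s bigs)
raise (intermediate (between _ small) _) (big ∷ _) = ⊥-elim (<⇒≱ small big)

raise-balanced : ∀ {j g ts} → Layered j false ts → All (λ t → 2 ^ j < leaves t) ts →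
                 Layered (suc j) g ts
raise-balanced [] [] = []
raise-balanced (balanced (inj₁ (#t , _)) _) (big ∷ _) = ⊥-elim (<-irrefl (sym #t) big)
raise-balanced (balanced (inj₂ b) s) (_ ∷ bigs) = balanced (inj₁ b) (raise-balanced s bigs)

All-pick : ∀ {P : Tree → Set} {x xs ys} → Pick x xs ys → All P xs → P x × All P ys
All-pick here (px ∷ pxs) = px , pxs
All-pick (there p) (py ∷ pxs) with All-pick p pxs
... | px , pys = px , py ∷ pys

Merged : Tree → Tree → List Tree → Set
Merged u v zs = RootSplit (node u v) × ∃ λ j → Layered j true (node u v ∷ zs)

merge-balanced : ∀ {j u v zs} → FullyBalanced j u → Picked j v zs true →
                 All (λ t → leaves v ≤ leaves t) zs → Merged u v zs
merge-balanced {j} bu (balanced (inj₁ bv) s) _ =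
  balanced bu bv , j , balanced (inj₂ (node-fullyBalanced bu bv)) s
merge-balanced {j} bu@(#u , _) (balanced (inj₂ bv@(#v , _)) s) v-min =
  balanced-taller bu bv , suc j ,
  intermediate (node-intermediate #u #v (+-monoʳ-< (2 ^ j) (2^n<2^[1+n] j))
                                        (+-monoˡ-< (2 ^ suc j) (2^n<2^[1+n] j)))
               (raise s (All.map (subst (_≤ _) #v) v-min))
merge-balanced {j} bu@(#u , _) (intermediate iv@(between lo hi) s) v-min =
  balanced-intermediate bu iv , suc j ,
  intermediate (node-intermediate #u refl (+-monoʳ-< (2 ^ j) lo) (+-mono-< (2^n<2^[1+n] j) hi))
               (raise-balanced s (All.map (<-≤-trans lo) v-min))

merge-taller : ∀ {j u v zs} → FullyBalanced (suc j) u → leaves u ≤ leaves v → Picked j v zs true →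
               All (λ t → leaves v ≤ leaves t) zs → Merged u v zs
merge-taller {j} (#u , _) u≤v (balanced (inj₁ (#v , _)) _) _ =
  ⊥-elim (<⇒≱ (2^n<2^[1+n] j) (subst₂ _≤_ #u #v u≤v))
merge-taller {j} bu _ (balanced (inj₂ bv@(#v , _)) s) v-min =
  balanced bu bv , suc j ,
  balanced (inj₂ (node-fullyBalanced bu bv)) (raise s (All.map (subst (_≤ _) #v) v-min))
merge-taller {j} {v = v} (#u , _) u≤v (intermediate (between _ hi) _) _ =
  ⊥-elim (<⇒≱ hi (subst (_≤ leaves v) #u u≤v))

merge-intermediate : ∀ {j u v zs} → Intermediate j u → leaves u ≤ leaves v → Picked j v zs false →
                     All (λ t → leaves v ≤ leaves t) zs → Merged u v zs
merge-intermediate {u = u} (between lo _) u≤v (balanced (inj₁ (#v , _)) _) _ =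
  ⊥-elim (<⇒≱ lo (subst (leaves u ≤_) #v u≤v))
merge-intermediate {j} iu@(between lo hi) _ (balanced (inj₂ bv@(#v , _)) s) v-min =
  intermediate-taller iu bv , suc j ,
  intermediate (node-intermediate refl #v (+-mono-< lo (2^n<2^[1+n] j)) (+-monoˡ-< (2 ^ suc j) hi))
               (raise s (All.map (subst (_≤ _) #v) v-min))

merge : ∀ {j xs ys zs u v} → Layered j true xs →
        Pick u xs ys → All (λ t → leaves u ≤ leaves t) ys →
        Pick v ys zs → All (λ t → leaves v ≤ leaves t) zs → Merged u v zs
merge s pu u-min pv v-min with pick-layered pu s
... | balanced (inj₁ bu) s₁ = merge-balanced bu (pick-layered pv s₁) v-min
... | balanced (inj₂ bu) s₁ = merge-taller bu (proj₁ (All-pick pv u-min)) (pick-layered pv s₁) v-min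
... | intermediate iu s₁    = merge-intermediate iu (proj₁ (All-pick pv u-min)) (pick-layered pv s₁) v-min

star-respects : ∀ {a r p} {A : Set a} {T : Rel A r} {P : A → Set p} → P Respects T → P Respects Star T
star-respects {P = P} P-step = fold (λ x y → P x → P y) (λ t P⇒ → P⇒ ∘ P-step t) id

GFBInvariant : List Tree → Set
GFBInvariant xs = (∃ λ j → Layered j true xs) × All RootSplit xs

gfbStep-invariant : GFBInvariant Respects GFBStep
gfbStep-invariant (step pu u-min pv v-min) ((_ , s) , splits) =
  let split , layered = merge s pu u-min pv v-min
  in layered , split ∷ proj₂ (All-pick pv (proj₂ (All-pick pu splits)))

leaves-layered : ∀ {g} n → Layered 0 g (replicate n leaf)
leaves-layered zero    = []
leaves-layered (suc n) = balanced (inj₁ (refl , leaf≅)) (leaves-layered n)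

totalLeaves : List Tree → ℕ
totalLeaves = sum ∘ map leaves

pick-totalLeaves : ∀ {x xs ys} → Pick x xs ys → totalLeaves xs ≡ leaves x + totalLeaves ys
pick-totalLeaves here = refl
pick-totalLeaves {x} (there {y = y} {ys = ys} p) =
  trans (cong (leaves y +_) (pick-totalLeaves p)) (x∙yz≈y∙xz (leaves y) (leaves x) (totalLeaves ys))

gfbStep-totalLeaves : ∀ {xs ys} → GFBStep xs ys → totalLeaves xs ≡ totalLeaves ys
gfbStep-totalLeaves {xs} (step {ys = ys} {zs} {u} {v} pu _ pv _) = begin
  totalLeaves xs                          ≡⟨ pick-totalLeaves pu ⟩
  leaves u + totalLeaves ys               ≡⟨ cong (leaves u +_) (pick-totalLeaves pv) ⟩
  leaves u + (leaves v + totalLeaves zs)  ≡⟨ +-assoc (leaves u) (leaves v) (totalLeaves zs) ⟨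
  leaves u + leaves v + totalLeaves zs    ∎
  where open ≡-Reasoning

totalLeaves-replicate : ∀ n → totalLeaves (replicate n leaf) ≡ n
totalLeaves-replicate zero    = refl
totalLeaves-replicate (suc n) = cong suc (totalLeaves-replicate n)

gfb-output : ∀ {n t} → IsGFB n t → RootSplit t × leaves t ≡ n
gfb-output {n} {t} gfb = split , trans (sym (+-identityʳ (leaves t))) count
  where
  split : RootSplit t
  split with star-respects gfbStep-invariant gfb ((0 , leaves-layered n) , replicate⁺ n leaf)
  ... | _ , split ∷ [] = split
  count : totalLeaves (t ∷ []) ≡ n
  count = star-respects (λ s → trans (sym (gfbStep-totalLeaves s))) gfb (totalLeaves-replicate n)

root-split-swap : ∀ {a b} → RootSplit (node a b) → leaves b ≤ leaves a → RootSplit (node b a)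
root-split-swap (balanced ba bb) _ = balanced bb ba
root-split-swap {b = b} (balanced-intermediate (#a , _) (between lo _)) b≤a =
  ⊥-elim (<⇒≱ lo (subst (leaves b ≤_) #a b≤a))
root-split-swap (balanced-taller {j} (#a , _) (#b , _)) b≤a =
  ⊥-elim (<⇒≱ (2^n<2^[1+n] j) (subst₂ _≤_ #b #a b≤a))
root-split-swap {a} (intermediate-taller (between _ hi) (#b , _)) b≤a =
  ⊥-elim (<⇒≱ hi (subst (_≤ leaves a) #b b≤a))

RootSplitCases : ℕ → ℕ → ℕ → ℕ → Tree → Tree → Set
RootSplitCases n k a b Ta Tb =
    ((2 * 2 ^ k < 4 * n) → (4 * n < 3 * 2 ^ k) →
    (4 * a + 2 ^ k ≡ 4 * n) × (4 * b ≡ 2 ^ k)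
    × (Tb ≅ fb (k ∸ 2)) × (⌈log₂ a ⌉ ≡ k ∸ 1))
    × ((4 * n ≡ 3 * 2 ^ k) →
    (2 * a ≡ 2 ^ k) × (4 * b ≡ 2 ^ k)
    × (Ta ≅ fb (k ∸ 1)) × (Tb ≅ fb (k ∸ 2)))
    × ((3 * 2 ^ k < 4 * n) → (4 * n ≤ 4 * 2 ^ k) →
    (2 * a ≡ 2 ^ k) × (2 * b + 2 ^ k ≡ 2 * n)
    × (Ta ≅ fb (k ∸ 1)) × (⌈log₂ b ⌉ ≡ k ∸ 1))

RootSplitCasesOf : Tree → Tree → Set
RootSplitCasesOf Ta Tb =
  let n = leaves Ta + leaves Tb in RootSplitCases n ⌈log₂ n ⌉ (leaves Ta) (leaves Tb) Ta Tb

4*[2*x+x]≡3*[2*[2*x]] : ∀ x → 4 * (2 * x + x) ≡ 3 * (2 * (2 * x))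
4*[2*x+x]≡3*[2*[2*x]] = solve-∀

4*x≡2*[2*x] : ∀ x → 4 * x ≡ 2 * (2 * x)
4*x≡2*[2*x] = solve-∀

cases-balanced : ∀ {j Ta Tb} → FullyBalanced j Tb → FullyBalanced j Ta →
                 RootSplitCasesOf Ta Tb
cases-balanced {j} {Ta} {Tb} (#b , _) (#a , Ta≅) rewrite #a | #b =
  subst (λ k → RootSplitCases (P + P) k P P Ta Tb) (sym ⌈log₂n⌉≡1+j) $
  (λ _ 4n<3·2^k → ⊥-elim (<-asym 4n<3·2^k 3·2^k<4n)) ,
  (λ 4n≡3·2^k → ⊥-elim (<-irrefl (sym 4n≡3·2^k) 3·2^k<4n)) ,
  (λ _ _ → refl , 2*x+2*x≡2*[x+x] P , Ta≅ , ⌈log₂2^n⌉≡n j)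
  where
  P = 2 ^ j
  ⌈log₂n⌉≡1+j : ⌈log₂ (P + P) ⌉ ≡ suc j
  ⌈log₂n⌉≡1+j = trans (cong ⌈log₂_⌉ (n+n≡2*n P)) (⌈log₂2^n⌉≡n (suc j))
  4*[x+x]≡3*[2*x]+2*x : ∀ x → 4 * (x + x) ≡ 3 * (2 * x) + 2 * x
  4*[x+x]≡3*[2*x]+2*x = solve-∀
  2*x+2*x≡2*[x+x] : ∀ x → 2 * x + 2 * x ≡ 2 * (x + x)
  2*x+2*x≡2*[x+x] = solve-∀
  3·2^k<4n : 3 * (2 * P) < 4 * (P + P)
  3·2^k<4n = subst (3 * (2 * P) <_) (sym (4*[x+x]≡3*[2*x]+2*x P))
                   (m<m+n (3 * (2 * P)) (m^n>0 2 (suc j)))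

cases-balanced-intermediate : ∀ {j Ta Tb} → FullyBalanced j Tb → Intermediate j Ta →
                              RootSplitCasesOf Ta Tb
cases-balanced-intermediate {j} {Ta} {Tb} (#b , Tb≅) (between lo hi) rewrite #b =
  subst (λ k → RootSplitCases (a + P) k a P Ta Tb) (sym ⌈log₂n⌉≡2+j) $
  (λ _ _ → 4*x+2*[2*y]≡4*[x+y] a P , 4*x≡2*[2*x] P , Tb≅ , ⌈log₂m⌉≡1+j j lo (<⇒≤ hi)) ,
  (λ 4n≡3·2^k → ⊥-elim (<-irrefl 4n≡3·2^k 4n<3·2^k)) ,
  (λ 3·2^k<4n _ → ⊥-elim (<-asym 3·2^k<4n 4n<3·2^k))
  where
  P = 2 ^ j
  a = leaves Ta
  ⌈log₂n⌉≡2+j : ⌈log₂ (a + P) ⌉ ≡ suc (suc j)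
  ⌈log₂n⌉≡2+j = ⌈log₂m⌉≡1+j (suc j)
    (subst (_< a + P) (n+n≡2*n P) (+-monoˡ-< P lo))
    (<⇒≤ (subst (a + P <_) (n+n≡2*n (2 * P)) (+-mono-<-≤ hi (<⇒≤ (2^n<2^[1+n] j)))))
  4*x+2*[2*y]≡4*[x+y] : ∀ x y → 4 * x + 2 * (2 * y) ≡ 4 * (x + y)
  4*x+2*[2*y]≡4*[x+y] = solve-∀
  4n<3·2^k : 4 * (a + P) < 3 * (2 * (2 * P))
  4n<3·2^k = subst (4 * (a + P) <_) (4*[2*x+x]≡3*[2*[2*x]] P) (*-monoʳ-< 4 (+-monoˡ-< P hi))

cases-balanced-taller : ∀ {j Ta Tb} → FullyBalanced j Tb → FullyBalanced (suc j) Ta →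
                        RootSplitCasesOf Ta Tb
cases-balanced-taller {j} {Ta} {Tb} (#b , Tb≅) (#a , Ta≅) rewrite #a | #b =
  subst (λ k → RootSplitCases (2 * P + P) k (2 * P) P Ta Tb) (sym ⌈log₂n⌉≡2+j) $
  (λ _ 4n<3·2^k → ⊥-elim (<-irrefl (4*[2*x+x]≡3*[2*[2*x]] P) 4n<3·2^k)) ,
  (λ _ → refl , 4*x≡2*[2*x] P , Ta≅ , Tb≅) ,
  (λ 3·2^k<4n _ → ⊥-elim (<-irrefl (sym (4*[2*x+x]≡3*[2*[2*x]] P)) 3·2^k<4n))
  where
  P = 2 ^ j
  ⌈log₂n⌉≡2+j : ⌈log₂ (2 * P + P) ⌉ ≡ suc (suc j)
  ⌈log₂n⌉≡2+j = ⌈log₂m⌉≡1+j (suc j)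
    (m<m+n (2 * P) (m^n>0 2 j))
    (subst (2 * P + P ≤_) (n+n≡2*n (2 * P)) (+-monoʳ-≤ (2 * P) (<⇒≤ (2^n<2^[1+n] j))))

cases-intermediate-taller : ∀ {j Ta Tb} → Intermediate j Tb → FullyBalanced (suc j) Ta →
                            RootSplitCasesOf Ta Tb
cases-intermediate-taller {j} {Ta} {Tb} (between lo hi) (#a , Ta≅) rewrite #a =
  subst (λ k → RootSplitCases (2 * P + b) k (2 * P) b Ta Tb) (sym ⌈log₂n⌉≡2+j) $
  (λ _ 4n<3·2^k → ⊥-elim (<-asym 4n<3·2^k 3·2^k<4n)) ,
  (λ 4n≡3·2^k → ⊥-elim (<-irrefl (sym 4n≡3·2^k) 3·2^k<4n)) ,
  (λ _ _ → refl , 2*x+2*[2*y]≡2*[2*y+x] b P , Ta≅ , ⌈log₂m⌉≡1+j j lo (<⇒≤ hi))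
  where
  P = 2 ^ j
  b = leaves Tb
  ⌈log₂n⌉≡2+j : ⌈log₂ (2 * P + b) ⌉ ≡ suc (suc j)
  ⌈log₂n⌉≡2+j = ⌈log₂m⌉≡1+j (suc j)
    (m<m+n (2 * P) (≤-<-trans z≤n lo))
    (<⇒≤ (subst (2 * P + b <_) (n+n≡2*n (2 * P)) (+-monoʳ-< (2 * P) hi)))
  2*x+2*[2*y]≡2*[2*y+x] : ∀ x y → 2 * x + 2 * (2 * y) ≡ 2 * (2 * y + x)
  2*x+2*[2*y]≡2*[2*y+x] = solve-∀
  3·2^k<4n : 3 * (2 * (2 * P)) < 4 * (2 * P + b)
  3·2^k<4n = subst (_< 4 * (2 * P + b)) (4*[2*x+x]≡3*[2*[2*x]] P) (*-monoʳ-< 4 (+-monoʳ-< (2 * P) lo))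

root-split-cases : ∀ {Ta Tb} → RootSplit (node Tb Ta) → RootSplitCasesOf Ta Tb
root-split-cases (balanced bb ba)              = cases-balanced bb ba
root-split-cases (balanced-intermediate bb ia) = cases-balanced-intermediate bb ia
root-split-cases (balanced-taller bb ba)       = cases-balanced-taller bb ba
root-split-cases (intermediate-taller ib ba)   = cases-intermediate-taller ib ba

proposition2 : ∀ (n : ℕ) (Ta Tb : Tree) → 2 ≤ n →
    (IsGFB n (node Ta Tb) ⊎ IsGFB n (node Tb Ta)) → leaves Tb ≤ leaves Ta →
    ((2 * 2 ^ ⌈log₂ n ⌉ < 4 * n) → (4 * n < 3 * 2 ^ ⌈log₂ n ⌉) →
      (4 * leaves Ta + 2 ^ ⌈log₂ n ⌉ ≡ 4 * n) × (4 * leaves Tb ≡ 2 ^ ⌈log₂ n ⌉)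
      × (Tb ≅ fb (⌈log₂ n ⌉ ∸ 2)) × (⌈log₂ leaves Ta ⌉ ≡ ⌈log₂ n ⌉ ∸ 1))
    × ((4 * n ≡ 3 * 2 ^ ⌈log₂ n ⌉) →
      (2 * leaves Ta ≡ 2 ^ ⌈log₂ n ⌉) × (4 * leaves Tb ≡ 2 ^ ⌈log₂ n ⌉)
      × (Ta ≅ fb (⌈log₂ n ⌉ ∸ 1)) × (Tb ≅ fb (⌈log₂ n ⌉ ∸ 2)))
    × ((3 * 2 ^ ⌈log₂ n ⌉ < 4 * n) → (4 * n ≤ 4 * 2 ^ ⌈log₂ n ⌉) →
      (2 * leaves Ta ≡ 2 ^ ⌈log₂ n ⌉) × (2 * leaves Tb + 2 ^ ⌈log₂ n ⌉ ≡ 2 * n)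
      × (Ta ≅ fb (⌈log₂ n ⌉ ∸ 1)) × (⌈log₂ leaves Tb ⌉ ≡ ⌈log₂ n ⌉ ∸ 1))
proposition2 n Ta Tb _ (inj₁ gfb) Tb≤Ta with gfb-output gfb
... | split , refl = root-split-cases (root-split-swap split Tb≤Ta)
proposition2 n Ta Tb _ (inj₂ gfb) _ with gfb-output gfb
... | split , refl =
  subst (λ m → RootSplitCases m ⌈log₂ m ⌉ (leaves Ta) (leaves Tb) Ta Tb) (+-comm (leaves Ta) (leaves Tb))
        (root-split-cases split)
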